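{- For any $q\ge 1$ and $n\ge 5$, the graph $A\Gamma_n^q$ is connected and non-bipartite.
   Context: $X=\{1,\dots,n\}$, $A_n$ the alternating group on $X$, $\mathcal{E}_n=\{\sigma\in A_n: i^\sigma\neq i \text{ for all } i\in X\}$. $A\Gamma_n$ is the Cayley graph $\Gamma(A_n,\mathcal{E}_n)$ (vertex set $A_n$, edges $\{g,sg\}$, $s\in\mathcal{E}_n$). The tensor product of graphs $\Gamma_1,\Gamma_2$ has vertex set $V(\Gamma_1)\times V(\Gamma_2)$, $(u_1,u_2)\sim(v_1,v_2)$ iff $u_1\sim v_1$ and $u_2\sim v_2$. $A\Gamma_n^q$ is the tensor product of $q$ copies of $A\Gamma_n$, with vertex set $A_n^q$. -}

module Defs where

open import Data.Nat using (ℕ; _<ᵇ_; _+_)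
open import Data.Nat.Divisibility using (_∣_)
open import Data.Fin using (Fin; toℕ)
open import Data.Vec using (Vec; lookup; tabulate)
open import Data.Vec.Relation.Binary.Pointwise.Inductive using (Pointwise)
open import Data.Vec.Relation.Unary.All using (All)
open import Data.List using (List; map; allFin)
open import Data.Nat.ListAction using (sum)
open import Data.Bool using (Bool; if_then_else_; _∧_)
open import Data.Product using (Σ; ∃; _×_)
open import Relation.Binary.PropositionalEquality using (_≡_; _≢_)
open import Relation.Binary.Construct.Closure.ReflexiveTransitive using (Star)
open import Relation.Nullary using (¬_)
open import Function.Definitions using (Injective)

-- A permutation of X = Fin n is represented by the vector of its images:
-- i ↦ lookup σ i  (i^σ in the paper's notation).
Perm : ℕ → Set
Perm n = Vec (Fin n) n

IsPerm : ∀ {n} → Perm n → Set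
IsPerm σ = Injective _≡_ _≡_ (lookup σ)

inversions : ∀ {n} → Perm n → ℕ
inversions {n} σ =
  sum (map (λ i → sum (map (λ j →
    if (toℕ i <ᵇ toℕ j) ∧ (toℕ (lookup σ j) <ᵇ toℕ (lookup σ i)) then 1 else 0)
    (allFin n))) (allFin n))

InA : ∀ {n} → Perm n → Set
InA σ = IsPerm σ × (2 ∣ inversions σ)

InE : ∀ {n} → Perm n → Set
InE σ = InA σ × (∀ i → lookup σ i ≢ i)

-- composition: i^(s g) = (i^s)^g, i.e. (s g) i = g (s i)
_·_ : ∀ {n} → Perm n → Perm n → Perm n
s · g = tabulate (λ i → lookup g (lookup s i))

-- adjacency in AΓ_n = Cay(A_n, E_n): g ~ s g with s ∈ E_n, g ∈ A_n
AdjA : ∀ {n} → Perm n → Perm n → Set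
AdjA {n} g h = InA g × InA h × Σ (Perm n) (λ s → InE s × h ≡ s · g)

VertexQ : ℕ → ℕ → Set
VertexQ n q = Vec (Perm n) q

AdjQ : ∀ {n q} → VertexQ n q → VertexQ n q → Set
AdjQ = Pointwise AdjA

InAq : ∀ {n q} → VertexQ n q → Set
InAq = All InA

ConnectedQ : ℕ → ℕ → Set
ConnectedQ n q = ∀ (u v : VertexQ n q) → InAq u → InAq v → Star AdjQ u v

BipartiteQ : ℕ → ℕ → Set
BipartiteQ n q = Σ (VertexQ n q → Bool) (λ c →
  ∀ (u v : VertexQ n q) → AdjQ u v → c u ≢ c v)

module Submission where

-- A walk of length k in AΓ_n leads from g to g ∘ t, t a product of k even derangements, and a
-- walk in AΓ_n^q is a q-tuple of walks of one common length. So it suffices to show that for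
-- n ≥ 5 every even permutation is a product of exactly k even derangements for all large k
-- (connectivity), and that the identity is a product of three of them (a triangle through the
-- identity in every coordinate: an odd closed walk, which no proper 2-colouring admits).

open import Defs
open import Algebra.Bundles using (CommutativeRing)
import Algebra.Properties.CommutativeMonoid.Sum as CommutativeMonoidSum
open import Data.Bool using (Bool; true; false; not; _∧_; _xor_; if_then_else_)
import Data.Bool.Properties as Boolₚ
open import Data.Fin using (Fin; zero; suc; toℕ; fromℕ<; punchOut)
open import Data.Fin.Patterns using (0F; 1F; 2F)
open import Data.Fin.Permutation using (permutation)
open import Data.Fin.Permutation.Components using (transpose)
open import Data.Fin.Properties using (_≟_; any?; toℕ-injective; toℕ-fromℕ<; toℕ<n; punchOut-injective; injective⇒≤)
open import Data.Fin.Subset using (Subset; _∈_; ∣_∣)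
open import Data.Fin.Subset.Properties using (p⊂q⇒∣p∣<∣q∣)
open import Data.List as List using ()
import Data.List.Properties as Listₚ
open import Data.Nat using (ℕ; zero; suc; _+_; _*_; _<_; _≤_; _<ᵇ_; z≤n; s≤s)
open import Data.Nat.Divisibility using (_∣_; divides)
open import Data.Nat.DivMod using (_%_; _/_; m%n<n; %-distribˡ-+; m%n%n≡m%n; [m+kn]%n≡m%n; m<n⇒m%n≡m; m≡m%n+[m/n]*n)
open import Data.Nat.Induction using (<-wellFounded)
open import Data.Nat.ListAction using (sum)
import Data.Nat.Properties as ℕₚ
open import Data.Product using (Σ; ∃; _×_; _,_; proj₁; proj₂)
open import Data.Vec as Vec using (Vec; []; _∷_; lookup; tabulate)
import Data.Vec.Properties as Vecₚ
open import Data.Vec.Relation.Binary.Pointwise.Inductive using (Pointwise; []; _∷_)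
open import Data.Vec.Relation.Unary.All using (All; []; _∷_)
open import Function using (_∘_; id; _⇔_; mk⇔; Equivalence)
open import Function.Definitions using (Injective)
open import Induction.WellFounded using (Acc; acc)
open import Relation.Binary.Construct.Closure.ReflexiveTransitive using (Star; ε; _◅_)
open import Relation.Binary.PropositionalEquality
open import Relation.Nullary using (¬_; yes; no; does; contradiction)
open import Relation.Nullary.Decidable using (dec-true; dec-false; ¬?; _×-dec_; decidable-stable)

private
  variable
    n : ℕ

Endo : ℕ → Set
Endo n = Fin n → Fin n

Inj : Endo n → Set
Inj f = Injective _≡_ _≡_ f

_≺_ : Fin n → Fin n → Bool
i ≺ j = toℕ i <ᵇ toℕ j

<ᵇ-irrefl : ∀ m → (m <ᵇ m) ≡ false
<ᵇ-irrefl zero    = refl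
<ᵇ-irrefl (suc m) = <ᵇ-irrefl m

<ᵇ-flip : ∀ m k → m ≢ k → (k <ᵇ m) ≡ not (m <ᵇ k)
<ᵇ-flip zero    zero    m≢k = contradiction refl m≢k
<ᵇ-flip zero    (suc k) _   = refl
<ᵇ-flip (suc m) zero    _   = refl
<ᵇ-flip (suc m) (suc k) m≢k = <ᵇ-flip m k (m≢k ∘ cong suc)

≺-irrefl : (i : Fin n) → (i ≺ i) ≡ false
≺-irrefl i = <ᵇ-irrefl (toℕ i)

≺-flip : {i j : Fin n} → i ≢ j → (j ≺ i) ≡ not (i ≺ j)
≺-flip i≢j = <ᵇ-flip _ _ (i≢j ∘ toℕ-injective)

≺⇒≢ : {i j : Fin n} → (i ≺ j) ≡ true → i ≢ j
≺⇒≢ {i = i} i≺j refl with () ← trans (sym i≺j) (≺-irrefl i)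

≺-asym : (i j : Fin n) → ((i ≺ j) ∧ (j ≺ i)) ≡ false
≺-asym i j with i ≺ j in i≺j
... | false = refl
... | true  = trans (≺-flip {i = i} {j} (≺⇒≢ i≺j)) (cong not i≺j)

xor-cancel : ∀ p {a b} → p xor a ≡ p xor b → a ≡ b
xor-cancel false eq = eq
xor-cancel true  eq = Boolₚ.not-injective eq

open CommutativeMonoidSum (CommutativeRing.+-commutativeMonoid Boolₚ.xor-∧-commutativeRing)
  using (sum-permute; ∑-comm; ∑-distrib-+; sum-cong-≗; sum-replicate-zero) renaming (sum to ⊕)

⊕⊕ : (Fin n → Fin n → Bool) → Bool
⊕⊕ K = ⊕ (λ i → ⊕ (K i))

⊕⊕-cong : {K L : Fin n → Fin n → Bool} → (∀ i j → K i j ≡ L i j) → ⊕⊕ K ≡ ⊕⊕ L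
⊕⊕-cong K≡L = sum-cong-≗ (λ i → sum-cong-≗ (K≡L i))

⊕⊕-xor : (K L : Fin n → Fin n → Bool) → ⊕⊕ (λ i j → K i j xor L i j) ≡ ⊕⊕ K xor ⊕⊕ L
⊕⊕-xor {n} K L = trans (sum-cong-≗ (λ i → ∑-distrib-+ {n} (K i) (L i)))
                       (∑-distrib-+ {n} (λ i → ⊕ (K i)) (λ i → ⊕ (L i)))

⊕-false : ∀ n → ⊕ {n} (λ _ → false) ≡ false
⊕-false = sum-replicate-zero

-- In characteristic 2 a symmetric kernel with zero diagonal sums to zero:
-- the terms K x y and K y x cancel.
⊕⊕-symmetric : (K : Fin n → Fin n → Bool) → (∀ x y → K x y ≡ K y x) → (∀ x → K x x ≡ false) →
               ⊕⊕ K ≡ false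
⊕⊕-symmetric {n} K K-sym K-diag = begin
  ⊕⊕ K                          ≡⟨ ⊕⊕-cong split ⟩
  ⊕⊕ (λ x y → A x y xor A y x)  ≡⟨ ⊕⊕-xor A (λ x y → A y x) ⟩
  ⊕⊕ A xor ⊕⊕ (λ x y → A y x)   ≡⟨ cong (⊕⊕ A xor_) (sym (∑-comm {n} {n} A)) ⟩
  ⊕⊕ A xor ⊕⊕ A                 ≡⟨ Boolₚ.xor-same (⊕⊕ A) ⟩
  false                         ∎
  where
  open ≡-Reasoning
  A : Fin n → Fin n → Bool
  A x y = (x ≺ y) ∧ K x y
  split : ∀ x y → K x y ≡ A x y xor A y x
  split x y with x ≟ y
  ... | yes refl rewrite ≺-irrefl x | K-diag x = refl
  ... | no x≢y rewrite ≺-flip x≢y | K-sym x y with x ≺ y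
  ...   | true  = sym (Boolₚ.xor-identityʳ _)
  ...   | false = refl

injective⇒onto : (f : Endo n) → Inj f → ∀ y → ∃ λ x → f x ≡ y
injective⇒onto {zero}  f f-inj ()
injective⇒onto {suc n} f f-inj y with any? (λ x → f x ≟ y)
... | yes found = found
... | no  ¬found = contradiction (injective⇒≤ g-inj) ℕₚ.1+n≰n
  where
  -- missing y, f would inject Fin (suc n) into Fin n
  y≢f : ∀ x → y ≢ f x
  y≢f x y≡fx = ¬found (x , sym y≡fx)
  g : Fin (suc n) → Fin n
  g x = punchOut (y≢f x)
  g-inj : Injective _≡_ _≡_ g
  g-inj {x} {x′} gx≡gx′ = f-inj (punchOut-injective (y≢f x) (y≢f x′) gx≡gx′)

inverse : (f : Endo n) → Inj f → Endo n
inverse f f-inj y = proj₁ (injective⇒onto f f-inj y)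

inverseʳ : (f : Endo n) (f-inj : Inj f) → ∀ y → f (inverse f f-inj y) ≡ y
inverseʳ f f-inj y = proj₂ (injective⇒onto f f-inj y)

inverseˡ : (f : Endo n) (f-inj : Inj f) → ∀ x → inverse f f-inj (f x) ≡ x
inverseˡ f f-inj x = f-inj (inverseʳ f f-inj (f x))

inverse-injective : (f : Endo n) (f-inj : Inj f) → Inj (inverse f f-inj)
inverse-injective f f-inj {x} {y} eq =
  trans (sym (inverseʳ f f-inj x)) (trans (cong f eq) (inverseʳ f f-inj y))

⊕-reindex : (g : Endo n) → Inj g → (φ : Fin n → Bool) → ⊕ (φ ∘ g) ≡ ⊕ φ
⊕-reindex g g-inj φ =
  sym (sum-permute φ (permutation g (inverse g g-inj) (inverseʳ g g-inj) (inverseˡ g g-inj)))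

⊕⊕-reindex : (g : Endo n) → Inj g → (K : Fin n → Fin n → Bool) → ⊕⊕ (λ x y → K (g x) (g y)) ≡ ⊕⊕ K
⊕⊕-reindex g g-inj K =
  trans (sum-cong-≗ (λ x → ⊕-reindex g g-inj (K (g x)))) (⊕-reindex g g-inj (λ x → ⊕ (K x)))

flips : Endo n → Fin n → Fin n → Bool
flips f x y = (x ≺ y) xor (f x ≺ f y)

flips-∘ : (f g : Endo n) → ∀ x y → flips (f ∘ g) x y ≡ flips g x y xor flips f (g x) (g y)
flips-∘ f g x y = begin
  a xor c                ≡⟨ cong (λ z → a xor (z xor c)) (sym (Boolₚ.xor-same b)) ⟩
  a xor ((b xor b) xor c) ≡⟨ cong (a xor_) (Boolₚ.xor-assoc b b c) ⟩
  a xor (b xor (b xor c)) ≡⟨ sym (Boolₚ.xor-assoc a b (b xor c)) ⟩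
  (a xor b) xor (b xor c) ∎
  where
  open ≡-Reasoning
  a = x ≺ y
  b = g x ≺ g y
  c = f (g x) ≺ f (g y)

flips-sym : (f : Endo n) → Inj f → ∀ x y → flips f x y ≡ flips f y x
flips-sym f f-inj x y with x ≟ y
... | yes refl = refl
... | no  x≢y  rewrite ≺-flip x≢y | ≺-flip (x≢y ∘ f-inj) =
  sym (Boolₚ.xor-annihilates-not (x ≺ y) (f x ≺ f y))

flips-diag : (f : Endo n) → ∀ x → flips f x x ≡ false
flips-diag f x = cong₂ _xor_ (≺-irrefl x) (≺-irrefl (f x))

half : (Fin n → Fin n → Bool) → Bool
half G = ⊕⊕ (λ x y → (x ≺ y) ∧ G x y)

half-cong : {G H : Fin n → Fin n → Bool} → (∀ x y → G x y ≡ H x y) → half G ≡ half H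
half-cong G≡H = ⊕⊕-cong (λ x y → cong ((x ≺ y) ∧_) (G≡H x y))

half-xor : (G H : Fin n → Fin n → Bool) → half (λ x y → G x y xor H x y) ≡ half G xor half H
half-xor G H = trans (⊕⊕-cong (λ x y → Boolₚ.∧-distribˡ-xor (x ≺ y) (G x y) (H x y)))
                     (⊕⊕-xor (λ x y → (x ≺ y) ∧ G x y) (λ x y → (x ≺ y) ∧ H x y))

-- For a symmetric kernel, the sum over pairs {x, y} is invariant under relabelling by a
-- permutation g: the two sums differ by the sum of G over the pairs whose order g reverses,
-- a symmetric kernel with zero diagonal.
half-reindex : (g : Endo n) → Inj g → (G : Fin n → Fin n → Bool) → (∀ x y → G x y ≡ G y x) →
               half (λ x y → G (g x) (g y)) ≡ half G
half-reindex {n} g g-inj G G-sym = sym (xor-cancel (half G′) (begin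
  half G′ xor half G
    ≡⟨ cong (half G′ xor_) (sym (⊕⊕-reindex g g-inj (λ x y → (x ≺ y) ∧ G x y))) ⟩
  half G′ xor ⊕⊕ (λ x y → (g x ≺ g y) ∧ G′ x y)
    ≡⟨ sym (⊕⊕-xor (λ x y → (x ≺ y) ∧ G′ x y) (λ x y → (g x ≺ g y) ∧ G′ x y)) ⟩
  ⊕⊕ (λ x y → ((x ≺ y) ∧ G′ x y) xor ((g x ≺ g y) ∧ G′ x y))
    ≡⟨ ⊕⊕-cong (λ x y → sym (Boolₚ.∧-distribʳ-xor (G′ x y) (x ≺ y) (g x ≺ g y))) ⟩
  ⊕⊕ (λ x y → flips g x y ∧ G′ x y)
    ≡⟨ ⊕⊕-symmetric _ (λ x y → cong₂ _∧_ (flips-sym g g-inj x y) (G-sym (g x) (g y)))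
                      (λ x → cong (_∧ G′ x x) (flips-diag g x)) ⟩
  false
    ≡⟨ sym (Boolₚ.xor-same (half G′)) ⟩
  half G′ xor half G′ ∎))
  where
  open ≡-Reasoning
  G′ : Fin n → Fin n → Bool
  G′ x y = G (g x) (g y)

parity : Endo n → Bool
parity f = ⊕⊕ (λ i j → (i ≺ j) ∧ (f j ≺ f i))

parity-half : (f : Endo n) → Inj f → parity f ≡ half (flips f)
parity-half f f-inj = ⊕⊕-cong inversion≡flip
  where
  inversion≡flip : ∀ i j → ((i ≺ j) ∧ (f j ≺ f i)) ≡ ((i ≺ j) ∧ flips f i j)
  inversion≡flip i j with i ≺ j in i≺j
  ... | false = refl
  ... | true  = ≺-flip (≺⇒≢ i≺j ∘ f-inj)

parity-cong : {f g : Endo n} → (∀ i → f i ≡ g i) → parity f ≡ parity g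
parity-cong f≗g = ⊕⊕-cong (λ i j → cong₂ (λ a b → (i ≺ j) ∧ (a ≺ b)) (f≗g j) (f≗g i))

parity-∘ : (f g : Endo n) → Inj f → Inj g → parity (f ∘ g) ≡ parity g xor parity f
parity-∘ f g f-inj g-inj = begin
  parity (f ∘ g)
    ≡⟨ parity-half (f ∘ g) (g-inj ∘ f-inj) ⟩
  half (flips (f ∘ g))
    ≡⟨ half-cong (flips-∘ f g) ⟩
  half (λ x y → flips g x y xor flips f (g x) (g y))
    ≡⟨ half-xor (flips g) (λ x y → flips f (g x) (g y)) ⟩
  half (flips g) xor half (λ x y → flips f (g x) (g y))
    ≡⟨ cong (half (flips g) xor_) (half-reindex g g-inj (flips f) (flips-sym f f-inj)) ⟩
  half (flips g) xor half (flips f)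
    ≡⟨ sym (cong₂ _xor_ (parity-half g g-inj) (parity-half f f-inj)) ⟩
  parity g xor parity f ∎
  where open ≡-Reasoning

-- parity id = parity id + parity id, hence parity id = 0.
parity-id : parity {n} id ≡ false
parity-id {n} = trans (parity-∘ {n} id id id id) (Boolₚ.xor-same (parity {n} id))

parity-conj : (f g π : Endo n) → Inj f → Inj g → Inj π → (∀ i → f (π i) ≡ π (g i)) → parity f ≡ parity g
parity-conj f g π f-inj g-inj π-inj fπ≡πg = xor-cancel (parity π) (begin
  parity π xor parity f ≡⟨ sym (parity-∘ f π f-inj π-inj) ⟩
  parity (f ∘ π)        ≡⟨ parity-cong {f = f ∘ π} {g = π ∘ g} fπ≡πg ⟩
  parity (π ∘ g)        ≡⟨ parity-∘ π g π-inj g-inj ⟩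
  parity g xor parity π ≡⟨ Boolₚ.xor-comm (parity g) (parity π) ⟩
  parity π xor parity g ∎)
  where open ≡-Reasoning

Even : Endo n → Set
Even f = Inj f × parity f ≡ false

even-cong : {f g : Endo n} → (∀ i → f i ≡ g i) → Even f → Even g
even-cong f≗g (f-inj , f-even) =
  (λ {x} {y} gx≡gy → f-inj (trans (f≗g x) (trans gx≡gy (sym (f≗g y))))) ,
  trans (sym (parity-cong f≗g)) f-even

even-∘ : {f g : Endo n} → Even f → Even g → Even (f ∘ g)
even-∘ {f = f} {g} (f-inj , f-even) (g-inj , g-even) =
  g-inj ∘ f-inj , trans (parity-∘ f g f-inj g-inj) (cong₂ _xor_ g-even f-even)

square-even : (f : Endo n) → Inj f → Even (f ∘ f)
square-even f f-inj = f-inj ∘ f-inj , trans (parity-∘ f f f-inj f-inj) (Boolₚ.xor-same (parity f))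

parity-inverse : (f : Endo n) (f-inj : Inj f) → parity (inverse f f-inj) ≡ parity f
parity-inverse {n} f f-inj = xor-cancel (parity f) (begin
  parity f xor parity f⁻¹ ≡⟨ Boolₚ.xor-comm (parity f) (parity f⁻¹) ⟩
  parity f⁻¹ xor parity f ≡⟨ sym (parity-∘ f f⁻¹ f-inj (inverse-injective f f-inj)) ⟩
  parity (f ∘ f⁻¹)        ≡⟨ parity-cong (inverseʳ f f-inj) ⟩
  parity {n} id           ≡⟨ parity-id {n} ⟩
  false                   ≡⟨ sym (Boolₚ.xor-same (parity f)) ⟩
  parity f xor parity f   ∎)
  where
  open ≡-Reasoning
  f⁻¹ = inverse f f-inj

even-inverse : (f : Endo n) (f-even : Even f) → Even (inverse f (proj₁ f-even))
even-inverse f (f-inj , f-even) = inverse-injective f f-inj , trans (parity-inverse f f-inj) f-even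

isOdd : ℕ → Bool
isOdd zero    = false
isOdd (suc k) = not (isOdd k)

isOdd-+ : ∀ a b → isOdd (a + b) ≡ isOdd a xor isOdd b
isOdd-+ zero    b = refl
isOdd-+ (suc a) b = trans (cong not (isOdd-+ a b)) (Boolₚ.not-distribˡ-xor (isOdd a) (isOdd b))

even⇔2∣ : ∀ a → isOdd a ≡ false ⇔ 2 ∣ a
even⇔2∣ a = mk⇔ (to a) from
  where
  to : ∀ a → isOdd a ≡ false → 2 ∣ a
  to zero          _    = divides 0 refl
  to (suc (suc a)) even with divides q refl ← to a (trans (sym (Boolₚ.not-involutive _)) even)
    = divides (suc q) refl
  from : 2 ∣ a → isOdd a ≡ false
  from (divides q refl) = double-even q
    where
    double-even : ∀ q → isOdd (q * 2) ≡ false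
    double-even zero    = refl
    double-even (suc q) = trans (Boolₚ.not-involutive _) (double-even q)

isOdd-sum : (h : Fin n → ℕ) → isOdd (sum (List.map h (List.allFin n))) ≡ ⊕ (isOdd ∘ h)
isOdd-sum {n} h = trans (cong (isOdd ∘ sum) (Listₚ.map-tabulate id h)) (tabulated n h)
  where
  tabulated : ∀ n (h : Fin n → ℕ) → isOdd (sum (List.tabulate h)) ≡ ⊕ (isOdd ∘ h)
  tabulated zero    h = refl
  tabulated (suc n) h = trans (isOdd-+ (h zero) _) (cong (isOdd (h zero) xor_) (tabulated n (h ∘ suc)))

parity-inversions : (σ : Perm n) → isOdd (inversions σ) ≡ parity (lookup σ)
parity-inversions {n} σ =
  trans (isOdd-sum row)
        (sum-cong-≗ (λ i → trans (isOdd-sum (indicator i))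
                                 (sum-cong-≗ (λ j → isOdd-indicator (inverted i j)))))
  where
  inverted : Fin n → Fin n → Bool
  inverted i j = (i ≺ j) ∧ (lookup σ j ≺ lookup σ i)
  indicator : Fin n → Fin n → ℕ
  indicator i j = if inverted i j then 1 else 0
  row : Fin n → ℕ
  row i = sum (List.map (indicator i) (List.allFin n))
  isOdd-indicator : ∀ b → isOdd (if b then 1 else 0) ≡ b
  isOdd-indicator true  = refl
  isOdd-indicator false = refl

InA⇔even : (σ : Perm n) → InA σ ⇔ Even (lookup σ)
InA⇔even σ = mk⇔
  (λ (σ-inj , 2∣inv) → σ-inj , trans (sym (parity-inversions σ)) (Equivalence.from (even⇔2∣ _) 2∣inv))
  (λ (σ-inj , σ-even) → σ-inj , Equivalence.to (even⇔2∣ _) (trans (parity-inversions σ) σ-even))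

transpose-left : (a b : Fin n) → transpose a b a ≡ b
transpose-left a b rewrite dec-true (a ≟ a) refl = refl

transpose-right : (a b : Fin n) → transpose a b b ≡ a
transpose-right a b with b ≟ a
... | yes b≡a = b≡a
... | no  _   rewrite dec-true (b ≟ b) refl = refl

transpose-other : {a b i : Fin n} → i ≢ a → i ≢ b → transpose a b i ≡ i
transpose-other {a = a} {b} {i} i≢a i≢b rewrite dec-false (i ≟ a) i≢a | dec-false (i ≟ b) i≢b = refl

data Position (a b : Fin n) (i : Fin n) : Set where
  left      : i ≡ a → Position a b i
  right     : i ≡ b → Position a b i
  elsewhere : i ≢ a → i ≢ b → Position a b i

position : (a b i : Fin n) → Position a b i
position a b i with i ≟ a | i ≟ b
... | yes i≡a | _        = left i≡a
... | no  _   | yes i≡b  = right i≡b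
... | no  i≢a | no  i≢b  = elsewhere i≢a i≢b

transpose-involutive : (a b i : Fin n) → transpose a b (transpose a b i) ≡ i
transpose-involutive a b i with position a b i
... | left refl  = trans (cong (transpose a b) (transpose-left a b)) (transpose-right a b)
... | right refl = trans (cong (transpose a b) (transpose-right a b)) (transpose-left a b)
... | elsewhere i≢a i≢b =
  trans (cong (transpose a b) (transpose-other i≢a i≢b)) (transpose-other i≢a i≢b)

transpose-injective : (a b : Fin n) → Inj (transpose a b)
transpose-injective a b {x} {y} eq =
  trans (sym (transpose-involutive a b x)) (trans (cong (transpose a b) eq) (transpose-involutive a b y))

transpose-conj : (π : Endo n) → Inj π → (a b i : Fin n) →
                 transpose (π a) (π b) (π i) ≡ π (transpose a b i)
transpose-conj π π-inj a b i with position a b i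
... | left refl  = trans (transpose-left (π a) (π b)) (cong π (sym (transpose-left a b)))
... | right refl = trans (transpose-right (π a) (π b)) (cong π (sym (transpose-right a b)))
... | elsewhere i≢a i≢b =
  trans (transpose-other (i≢a ∘ π-inj) (i≢b ∘ π-inj)) (cong π (sym (transpose-other i≢a i≢b)))

redirect : Endo n → Fin n → Fin n → Endo n
redirect π k a = transpose (π k) a ∘ π

redirect-injective : (π : Endo n) → Inj π → ∀ k a → Inj (redirect π k a)
redirect-injective π π-inj k a = π-inj ∘ transpose-injective (π k) a

redirect-at : (π : Endo n) → ∀ k a → redirect π k a k ≡ a
redirect-at π k a = transpose-left (π k) a

redirect-away : (π : Endo n) → ∀ k a j → π j ≢ π k → π j ≢ a → redirect π k a j ≡ π j
redirect-away π k a j = transpose-other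

place₂ : ∀ {m} (a b : Fin (2 + m)) → a ≢ b →
         ∃ λ π → Inj π × π 0F ≡ a × π 1F ≡ b
place₂ a b a≢b =
  π , redirect-injective π₀ (transpose-injective 0F a) 1F b ,
  trans (redirect-away π₀ 1F b 0F (λ eq → 0≢1 (transpose-injective 0F a eq))
                          (λ eq → a≢b (trans (sym (transpose-left 0F a)) eq)))
        (transpose-left 0F a) ,
  redirect-at π₀ 1F b
  where
  π₀ = transpose 0F a
  π = redirect π₀ 1F b
  0≢1 : 0F ≢ 1F
  0≢1 ()

place₃ : ∀ {m} (a b c : Fin (3 + m)) → a ≢ b → a ≢ c → b ≢ c →
         ∃ λ π → Inj π × π 0F ≡ a × π 1F ≡ b × π 2F ≡ c
place₃ a b c a≢b a≢c b≢c with place₂ a b a≢b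
... | π₀ , π₀-inj , π₀0≡a , π₀1≡b =
  redirect π₀ 2F c , redirect-injective π₀ π₀-inj 2F c ,
  trans (redirect-away π₀ 2F c 0F (λ eq → 0≢2 (π₀-inj eq)) (λ eq → a≢c (trans (sym π₀0≡a) eq)))
        π₀0≡a ,
  trans (redirect-away π₀ 2F c 1F (λ eq → 1≢2 (π₀-inj eq)) (λ eq → b≢c (trans (sym π₀1≡b) eq)))
        π₀1≡b ,
  redirect-at π₀ 2F c
  where
  0≢2 : 0F ≢ 2F
  0≢2 ()
  1≢2 : 1F ≢ 2F
  1≢2 ()

-- transpose 0 1 has exactly one inversion, the pair (0, 1).
parity-transpose₀₁ : ∀ {m} → parity (transpose {2 + m} 0F 1F) ≡ true
parity-transpose₀₁ {m} = begin
  parity t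
    ≡⟨⟩
  ⊕ (row 0F) xor (⊕ (row 1F) xor ⊕ (λ k → ⊕ (row (suc (suc k)))))
    ≡⟨ cong₂ _xor_ row₀ (cong₂ _xor_ row₁ rows) ⟩
  true ∎
  where
  open ≡-Reasoning
  t : Endo (2 + m)
  t = transpose 0F 1F
  row : Fin (2 + m) → Fin (2 + m) → Bool
  row i j = (i ≺ j) ∧ (t j ≺ t i)
  row₀ : ⊕ (row 0F) ≡ true
  row₀ = cong (true xor_) (⊕-false m)
  row₁ : ⊕ (row 1F) ≡ false
  row₁ = trans (sum-cong-≗ {x = row 1F} (λ j → Boolₚ.∧-zeroʳ (1F ≺ j))) (⊕-false (2 + m))
  rows : ⊕ (λ k → ⊕ (row (suc (suc k)))) ≡ false
  rows = trans (sum-cong-≗ (λ k → trans (sum-cong-≗ {x = λ l → row (suc (suc k)) (suc (suc l))}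
                                                    (λ l → ≺-asym (suc (suc k)) (suc (suc l))))
                                       (⊕-false m)))
               (⊕-false m)

-- Every transposition is odd: it is conjugate to transpose 0 1.
parity-transpose : {a b : Fin n} → a ≢ b → parity (transpose a b) ≡ true
parity-transpose {suc zero}    {0F} {0F} a≢b = contradiction refl a≢b
parity-transpose {suc (suc m)} {a}  {b}  a≢b with place₂ a b a≢b
... | π , π-inj , refl , refl =
  trans (parity-conj (transpose (π 0F) (π 1F)) (transpose 0F 1F) π
                     (transpose-injective _ _) (transpose-injective 0F 1F) π-inj
                     (transpose-conj π π-inj 0F 1F))
        (parity-transpose₀₁ {m})

-- The 3-cycle a ↦ c ↦ b ↦ a, written as a product of two transpositions.
cycle3 : Fin n → Fin n → Fin n → Endo n
cycle3 a b c = transpose a b ∘ transpose a c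

cycle3-injective : (a b c : Fin n) → Inj (cycle3 a b c)
cycle3-injective a b c = transpose-injective a c ∘ transpose-injective a b

cycle3-even : {a b c : Fin n} → a ≢ b → a ≢ c → Even (cycle3 a b c)
cycle3-even {a = a} {b} {c} a≢b a≢c =
  cycle3-injective a b c ,
  trans (parity-∘ (transpose a b) (transpose a c) (transpose-injective a b) (transpose-injective a c))
        (cong₂ _xor_ (parity-transpose a≢c) (parity-transpose a≢b))

cycle3-conj : (π : Endo n) → Inj π → (a b c i : Fin n) →
              cycle3 (π a) (π b) (π c) (π i) ≡ π (cycle3 a b c i)
cycle3-conj π π-inj a b c i =
  trans (cong (transpose (π a) (π b)) (transpose-conj π π-inj a c i))
        (transpose-conj π π-inj a b (transpose a c i))

support : Endo n → Subset n
support t = tabulate (λ i → not (does (t i ≟ i)))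

moved⇒∈support : (t : Endo n) → ∀ {x} → t x ≢ x → x ∈ support t
moved⇒∈support t {x} tx≢x = Vecₚ.lookup⇒[]= x (support t)
  (trans (Vecₚ.lookup∘tabulate _ x) (cong not (dec-false (t x ≟ x) tx≢x)))

∈support⇒moved : (t : Endo n) → ∀ {x} → x ∈ support t → t x ≢ x
∈support⇒moved t {x} x∈supp tx≡x with () ←
  trans (sym (cong not (dec-true (t x ≟ x) tx≡x)))
        (trans (sym (Vecₚ.lookup∘tabulate _ x)) (Vecₚ.[]=⇒lookup x∈supp))

support-shrinks : (t t′ : Endo n) → (∀ i → t i ≡ i → t′ i ≡ i) → ∀ {x} → t′ x ≡ x → t x ≢ x →
                  ∣ support t′ ∣ < ∣ support t ∣
support-shrinks t t′ keeps t′x≡x tx≢x = p⊂q⇒∣p∣<∣q∣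
  ( (λ {i} i∈supp′ → moved⇒∈support t (∈support⇒moved t′ i∈supp′ ∘ keeps i))
  , _ , moved⇒∈support t tx≢x , (λ x∈supp′ → ∈support⇒moved t′ x∈supp′ t′x≡x) )

EvenDerangement : Endo n → Set
EvenDerangement s = Even s × (∀ i → s i ≢ i)

-- 'Product k t': t = s₁ ∘ ⋯ ∘ sₖ (pointwise) for even derangements s₁, …, sₖ.
-- This is exactly what is needed for a walk of length k from g to g ∘ t in AΓ_n.
data Product {n : ℕ} : ℕ → Endo n → Set where
  empty   : ∀ {t} → (∀ i → t i ≡ i) → Product 0 t
  prepend : ∀ {k t} (s t′ : Endo n) → EvenDerangement s → Product k t′ →
            (∀ i → t i ≡ s (t′ i)) → Product (suc k) t

product-cong : ∀ {k} {t u : Endo n} → Product k t → (∀ i → t i ≡ u i) → Product k u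
product-cong (empty t≗id) t≗u = empty (λ i → trans (sym (t≗u i)) (t≗id i))
product-cong (prepend s t′ s-der p t≗st′) t≗u =
  prepend s t′ s-der p (λ i → trans (sym (t≗u i)) (t≗st′ i))

product-∘ : ∀ {k l} {a b : Endo n} → Product k a → Product l b → Product (k + l) (a ∘ b)
product-∘ {b = b} (empty a≗id) pb = product-cong pb (λ i → sym (a≗id (b i)))
product-∘ {b = b} (prepend s a′ s-der pa a≗sa′) pb =
  prepend s (a′ ∘ b) s-der (product-∘ pa pb) (a≗sa′ ∘ b)

-- Relabelling by a permutation π: if t ∘ π = π ∘ u and u is a product of k even
-- derangements, so is t (conjugate each factor by π).
product-conj : ∀ {k} (π : Endo n) → Inj π → {t u : Endo n} → (∀ i → t (π i) ≡ π (u i)) →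
               Product k u → Product k t
product-conj π π-inj {t} {u} tπ≡πu (empty u≗id) = empty λ j → begin
  t j               ≡⟨ cong t (sym (inverseʳ π π-inj j)) ⟩
  t (π (π⁻¹ j))     ≡⟨ tπ≡πu (π⁻¹ j) ⟩
  π (u (π⁻¹ j))     ≡⟨ cong π (u≗id (π⁻¹ j)) ⟩
  π (π⁻¹ j)         ≡⟨ inverseʳ π π-inj j ⟩
  j                 ∎
  where
  open ≡-Reasoning
  π⁻¹ = inverse π π-inj
product-conj π π-inj {t} {u} tπ≡πu (prepend s u′ ((s-inj , s-even) , s-der) p u≗su′) =
  prepend (conj s) (conj u′) (conj-even , conj-derangement)
          (product-conj π π-inj (conj-spec u′) p) t≗ss′
  where
  open ≡-Reasoning
  π⁻¹ = inverse π π-inj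
  conj : Endo _ → Endo _
  conj f = π ∘ f ∘ π⁻¹
  conj-spec : ∀ f i → conj f (π i) ≡ π (f i)
  conj-spec f i = cong (π ∘ f) (inverseˡ π π-inj i)
  conj-even : Even (conj s)
  conj-even =
    conj-inj , trans (parity-conj (conj s) s π conj-inj s-inj π-inj (conj-spec s)) s-even
    where
    conj-inj : Inj (conj s)
    conj-inj = inverse-injective π π-inj ∘ s-inj ∘ π-inj
  conj-derangement : ∀ j → conj s j ≢ j
  conj-derangement j eq = s-der (π⁻¹ j) (π-inj (trans eq (sym (inverseʳ π π-inj j))))
  t≗ss′ : ∀ j → t j ≡ conj s (conj u′ j)
  t≗ss′ j = begin
    t j                 ≡⟨ cong t (sym (inverseʳ π π-inj j)) ⟩
    t (π (π⁻¹ j))       ≡⟨ tπ≡πu (π⁻¹ j) ⟩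
    π (u (π⁻¹ j))       ≡⟨ cong π (u≗su′ (π⁻¹ j)) ⟩
    π (s (u′ (π⁻¹ j)))  ≡⟨ sym (conj-spec s (u′ (π⁻¹ j))) ⟩
    conj s (conj u′ j)  ∎

product₁ : {s : Endo n} → EvenDerangement s → Product 1 s
product₁ {s = s} s-der = prepend s id s-der (empty (λ _ → refl)) (λ _ → refl)

derangement-inverse : (s : Endo n) (s-der : EvenDerangement s) →
                      EvenDerangement (inverse s (proj₁ (proj₁ s-der)))
derangement-inverse s ((s-inj , s-even) , s-fixless) =
  even-inverse s (s-inj , s-even) ,
  λ i s⁻¹i≡i → s-fixless i (trans (cong s (sym s⁻¹i≡i)) (inverseʳ s s-inj i))

few-moved⇒transpose : (t : Endo n) → Inj t → ∀ x → t x ≢ x → (∀ u → u ≢ x → u ≢ t x → t u ≡ u) →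
                      ∀ i → t i ≡ transpose x (t x) i
few-moved⇒transpose t t-inj x tx≢x fixes i with position x (t x) i
... | left refl  = sym (transpose-left x (t x))
... | right refl = trans t[tx]≡x (sym (transpose-right x (t x)))
  where
  -- otherwise t (t x) would lie outside {x, t x}, hence be fixed by t, forcing t x = x
  t[tx]≡x : t (t x) ≡ x
  t[tx]≡x with t (t x) ≟ x
  ... | yes eq = eq
  ... | no  ne = contradiction (fixes (t (t x)) ne (tx≢x ∘ t-inj)) (tx≢x ∘ t-inj ∘ t-inj)
... | elsewhere i≢x i≢tx = trans (fixes i i≢x i≢tx) (sym (transpose-other i≢x i≢tx))

-- An even permutation moving x moves a third point outside {x, t x}:
-- otherwise it would be a transposition, which is odd.
third-moved-point : (t : Endo n) → Even t → ∀ x → t x ≢ x → ∃ λ u → u ≢ x × u ≢ t x × t u ≢ u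
third-moved-point t (t-inj , t-even) x tx≢x
  with any? (λ u → ¬? (u ≟ x) ×-dec ¬? (u ≟ t x) ×-dec ¬? (t u ≟ u))
... | yes found = found
... | no  none  = contradiction (trans (sym t-odd) t-even) λ ()
  where
  fixes : ∀ u → u ≢ x → u ≢ t x → t u ≡ u
  fixes u u≢x u≢tx = decidable-stable (t u ≟ u) (λ tu≢u → none (u , u≢x , u≢tx , tu≢u))
  t-odd : parity t ≡ true
  t-odd = trans (parity-cong (few-moved⇒transpose t t-inj x tx≢x fixes)) (parity-transpose (tx≢x ∘ sym))

-- With x moved by t and a third moved point u outside {x, t x}, the
-- permutation t′ = cycle3 x (t x) u ∘ t fixes x and every fixed point of t, and t is recovered
-- from t′ by the inverse 3-cycle, cycle3 x u (t x).
module Reduction (t : Endo n) (t-inj : Inj t) (x u : Fin n)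
                 (tx≢x : t x ≢ x) (u≢x : u ≢ x) (u≢tx : u ≢ t x) (tu≢u : t u ≢ u) where

  t′ : Endo n
  t′ = cycle3 x (t x) u ∘ t

  t′-fixes-x : t′ x ≡ x
  t′-fixes-x = trans (cong (transpose x (t x)) (transpose-other tx≢x (u≢tx ∘ sym)))
                     (transpose-right x (t x))

  t′-keeps-fixed : ∀ i → t i ≡ i → t′ i ≡ i
  t′-keeps-fixed i ti≡i = begin
    transpose x (t x) (transpose x u (t i)) ≡⟨ cong (transpose x (t x) ∘ transpose x u) ti≡i ⟩
    transpose x (t x) (transpose x u i)     ≡⟨ cong (transpose x (t x)) (transpose-other i≢x i≢u) ⟩
    transpose x (t x) i                     ≡⟨ transpose-other i≢x i≢tx ⟩
    i                                       ∎
    where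
    open ≡-Reasoning
    i≢x : i ≢ x
    i≢x refl = tx≢x ti≡i
    i≢tx : i ≢ t x
    i≢tx refl = tx≢x (t-inj ti≡i)
    i≢u : i ≢ u
    i≢u refl = tu≢u ti≡i

  t-from-t′ : ∀ i → t i ≡ cycle3 x u (t x) (t′ i)
  t-from-t′ i = sym (begin
    transpose x u (transpose x (t x) (transpose x (t x) (transpose x u (t i))))
      ≡⟨ cong (transpose x u) (transpose-involutive x (t x) (transpose x u (t i))) ⟩
    transpose x u (transpose x u (t i))
      ≡⟨ transpose-involutive x u (t i) ⟩
    t i ∎)
    where open ≡-Reasoning

-- Every even permutation is a product of even derangements, provided every 3-cycle is one:
-- peel off 3-cycles, by well-founded recursion on the size of the support.
even⇒product : (∀ {a b c : Fin n} → a ≢ b → a ≢ c → b ≢ c → Product 2 (cycle3 a b c)) →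
               (t : Endo n) → Even t → ∃ λ k → Product k t
even⇒product {n} cycles t = go t (<-wellFounded ∣ support t ∣)
  where
  go : (t : Endo n) → Acc _<_ ∣ support t ∣ → Even t → ∃ λ k → Product k t
  go t (acc smaller) t-even with any? (λ x → ¬? (t x ≟ x))
  ... | no  none         = 0 , empty (λ i → decidable-stable (t i ≟ i) (λ ti≢i → none (i , ti≢i)))
  ... | yes (x , tx≢x) with third-moved-point t t-even x tx≢x
  ...   | u , u≢x , u≢tx , tu≢u =
    2 + proj₁ rest , product-cong (product-∘ back (proj₂ rest)) (sym ∘ t-from-t′)
    where
    open Reduction t (proj₁ t-even) x u tx≢x u≢x u≢tx tu≢u
    rest : ∃ λ k → Product k t′
    rest = go t′ (smaller (support-shrinks t t′ t′-keeps-fixed t′-fixes-x tx≢x))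
                 (even-∘ (cycle3-even (tx≢x ∘ sym) (u≢x ∘ sym)) t-even)
    back : Product 2 (cycle3 x u (t x))
    back = cycles (u≢x ∘ sym) (tx≢x ∘ sym) u≢tx

data Walk {A : Set} (R : A → A → Set) : ℕ → A → A → Set where
  stay : ∀ {x} → Walk R 0 x x
  _▸_  : ∀ {k x y z} → R x y → Walk R k y z → Walk R (suc k) x z

infixr 5 _▸_

walk⇒star : ∀ {A : Set} {R : A → A → Set} {k x y} → Walk R k x y → Star R x y
walk⇒star stay       = ε
walk⇒star (r ▸ walk) = r ◅ walk⇒star walk

walk-∷ : ∀ {A : Set} {R : A → A → Set} {k q x y} {xs ys : Vec A q} →
         Walk R k x y → Walk (Pointwise R) k xs ys → Walk (Pointwise R) k (x ∷ xs) (y ∷ ys)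
walk-∷ stay       stay         = stay
walk-∷ (r ▸ walk) (rs ▸ walks) = (r ∷ rs) ▸ walk-∷ walk walks

walk-[] : ∀ {A : Set} {R : A → A → Set} k → Walk (Pointwise R) k [] []
walk-[] zero    = stay
walk-[] (suc k) = [] ▸ walk-[] k

LongWalks : {A : Set} → (A → A → Set) → A → A → Set
LongWalks R x y = ∃ λ K → ∀ j → Walk R (K + j) x y

-- If any two vertices of P are joined by long walks, so are any two q-tuples of them
-- in the tensor power (take the sum of the thresholds).
tensor-long-walks : ∀ {A : Set} {R : A → A → Set} {P : A → Set} →
                    (∀ {x y} → P x → P y → LongWalks R x y) →
                    ∀ {q} {xs ys : Vec A q} → All P xs → All P ys → LongWalks (Pointwise R) xs ys
tensor-long-walks joined []         []         = 0 , walk-[]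
tensor-long-walks {R = R} joined {xs = x ∷ xs} {y ∷ ys} (px ∷ pxs) (py ∷ pys)
  with K , walks ← joined px py | L , walks′ ← tensor-long-walks joined pxs pys =
  K + L , λ j → walk-∷ (subst (λ l → Walk R l x y) (sym (ℕₚ.+-assoc K L j)) (walks (L + j)))
                       (subst (λ l → Walk (Pointwise R) l xs ys) (reorder j) (walks′ (K + j)))
  where
  reorder : ∀ j → L + (K + j) ≡ K + L + j
  reorder j = trans (sym (ℕₚ.+-assoc L K j)) (cong (_+ j) (ℕₚ.+-comm L K))

-- A proper 2-colouring alternates along a walk, so it changes exactly along walks of odd length.
colour-along-walk : ∀ {A : Set} {R : A → A → Set} (c : A → Bool) → (∀ u v → R u v → c u ≢ c v) →
                    ∀ {k x y} → Walk R k x y → c y ≡ isOdd k xor c x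
colour-along-walk c proper stay = refl
colour-along-walk c proper {suc k} {x} (_▸_ {y = y} r walk) = begin
  c _                    ≡⟨ colour-along-walk c proper walk ⟩
  isOdd k xor c y        ≡⟨ cong (isOdd k xor_) (Boolₚ.¬-not (proper x y r ∘ sym)) ⟩
  isOdd k xor not (c x)  ≡⟨ sym (Boolₚ.not-distribʳ-xor (isOdd k) (c x)) ⟩
  not (isOdd k xor c x)  ≡⟨ Boolₚ.not-distribˡ-xor (isOdd k) (c x) ⟩
  not (isOdd k) xor c x  ∎
  where open ≡-Reasoning

odd-closed-walk⇒¬2-colourable : ∀ {A : Set} {R : A → A → Set} {k x} →
                                 Walk R k x x → isOdd k ≡ true →
                                 ¬ (Σ (A → Bool) λ c → ∀ u v → R u v → c u ≢ c v)
odd-closed-walk⇒¬2-colourable {k = k} {x} walk k-odd (c , proper) =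
  Boolₚ.not-¬ refl (trans (colour-along-walk c proper walk) (cong (_xor c x) k-odd))

lookup-ext : ∀ {A : Set} (xs ys : Vec A n) → (∀ i → lookup xs i ≡ lookup ys i) → xs ≡ ys
lookup-ext xs ys eq =
  trans (sym (Vecₚ.tabulate∘lookup xs)) (trans (Vecₚ.tabulate-cong eq) (Vecₚ.tabulate∘lookup ys))

-- A product of k even derangements t gives a walk of length k in AΓ_n from g to g ∘ t:
-- the step by s is g ↦ s · g, whose lookup is lookup g ∘ s.
product⇒walk : ∀ {k} {t : Endo n} → Product k t → (g h : Perm n) → InA g →
               (∀ i → lookup h i ≡ lookup g (t i)) → Walk AdjA k g h
product⇒walk (empty t≗id) g h g∈A h≗gt =
  subst (Walk AdjA 0 g) (lookup-ext g h (λ i → sym (trans (h≗gt i) (cong (lookup g) (t≗id i))))) stay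
product⇒walk (prepend s t′ (s-even , s-fixless) p t≗st′) g h g∈A h≗gt =
  (g∈A , g′∈A , tabulate s , (s∈A , s-fixless′) , refl) ▸ product⇒walk p g′ h g′∈A h≗g′t′
  where
  g′ = tabulate s · g
  g′≗gs : ∀ i → lookup g′ i ≡ lookup g (s i)
  g′≗gs i = trans (Vecₚ.lookup∘tabulate _ i) (cong (lookup g) (Vecₚ.lookup∘tabulate s i))
  s∈A : InA (tabulate s)
  s∈A = Equivalence.from (InA⇔even (tabulate s)) (even-cong (sym ∘ Vecₚ.lookup∘tabulate s) s-even)
  s-fixless′ : ∀ i → lookup (tabulate s) i ≢ i
  s-fixless′ i eq = s-fixless i (trans (sym (Vecₚ.lookup∘tabulate s i)) eq)
  g′∈A : InA g′
  g′∈A = Equivalence.from (InA⇔even g′)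
           (even-cong (sym ∘ g′≗gs) (even-∘ (Equivalence.to (InA⇔even g) g∈A) s-even))
  h≗g′t′ : ∀ i → lookup h i ≡ lookup g′ (t′ i)
  h≗g′t′ i = trans (h≗gt i) (trans (cong (lookup g) (t≗st′ i)) (sym (g′≗gs (t′ i))))

rotate : ∀ {m} → ℕ → Endo (suc m)
rotate {m} k i = fromℕ< (m%n<n (toℕ i + k) (suc m))

toℕ-rotate : ∀ {m} k (i : Fin (suc m)) → toℕ (rotate k i) ≡ (toℕ i + k) % suc m
toℕ-rotate {m} k i = toℕ-fromℕ< (m%n<n (toℕ i + k) (suc m))

rotate-+ : ∀ {m} a b (i : Fin (suc m)) → rotate a (rotate b i) ≡ rotate (b + a) i
rotate-+ {m} a b i = toℕ-injective (begin
  toℕ (rotate a (rotate b i))  ≡⟨ toℕ-rotate a (rotate b i) ⟩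
  (toℕ (rotate b i) + a) % d   ≡⟨ cong (λ z → (z + a) % d) (toℕ-rotate b i) ⟩
  ((x + b) % d + a) % d        ≡⟨ %-distribˡ-+ ((x + b) % d) a d ⟩
  ((x + b) % d % d + a % d) % d ≡⟨ cong (λ z → (z + a % d) % d) (m%n%n≡m%n (x + b) d) ⟩
  ((x + b) % d + a % d) % d    ≡⟨ sym (%-distribˡ-+ (x + b) a d) ⟩
  (x + b + a) % d              ≡⟨ cong (_% d) (ℕₚ.+-assoc x b a) ⟩
  (x + (b + a)) % d            ≡⟨ sym (toℕ-rotate (b + a) i) ⟩
  toℕ (rotate (b + a) i)       ∎)
  where
  open ≡-Reasoning
  d = suc m
  x = toℕ i

-- A rotation is a permutation: rotating further by m · k places brings every point back.
rotate-injective : ∀ {m} k → Inj (rotate {m} k)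
rotate-injective {m} k {i} {j} eq = trans (sym (undo i)) (trans (cong (rotate (m * k)) eq) (undo j))
  where
  undo : ∀ i → rotate (m * k) (rotate k i) ≡ i
  undo i = trans (rotate-+ (m * k) k i) (toℕ-injective (begin
    toℕ (rotate (suc m * k) i)     ≡⟨ toℕ-rotate (suc m * k) i ⟩
    (toℕ i + suc m * k) % suc m    ≡⟨ cong (λ z → (toℕ i + z) % suc m) (ℕₚ.*-comm (suc m) k) ⟩
    (toℕ i + k * suc m) % suc m    ≡⟨ [m+kn]%n≡m%n (toℕ i) k (suc m) ⟩
    toℕ i % suc m                  ≡⟨ m<n⇒m%n≡m (toℕ<n i) ⟩
    toℕ i                          ∎))
    where open ≡-Reasoning

rotate-derangement : ∀ {m} k → 0 < k → k < suc m → ∀ (i : Fin (suc m)) → rotate k i ≢ i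
rotate-derangement {m} k 0<k k<n i rot≡i = k≢multiple q (ℕₚ.+-cancelˡ-≡ x k (q * suc m) x+k≡x+qn)
  where
  x = toℕ i
  q = (x + k) / suc m
  x+k≡x+qn : x + k ≡ x + q * suc m
  x+k≡x+qn = trans (m≡m%n+[m/n]*n (x + k) (suc m))
                   (cong (_+ q * suc m) (trans (sym (toℕ-rotate k i)) (cong toℕ rot≡i)))
  k≢multiple : ∀ q → k ≢ q * suc m
  k≢multiple zero    refl = ℕₚ.<-irrefl refl 0<k
  k≢multiple (suc q) refl = ℕₚ.<-irrefl refl (ℕₚ.≤-trans k<n (ℕₚ.m≤m+n (suc m) (q * suc m)))

toℕ-rotate-small : ∀ {m} k (i : Fin (suc m)) → toℕ i + k < suc m → toℕ (rotate k i) ≡ toℕ i + k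
toℕ-rotate-small k i i+k<n = trans (toℕ-rotate k i) (m<n⇒m%n≡m i+k<n)

-- Rotation by two places is an even derangement whose square
-- (rotation by four) is again a derangement, and composed with the 3-cycle c₀ = (0 2 1)
-- it still has no fixed point. This yields the identity as a product of 2 and of 3 even
-- derangements, and every 3-cycle as a product of 2.
module AtLeastFive (m : ℕ) where

  2<5+m : 2 < 5 + m
  2<5+m = ℕₚ.m≤m+n 3 (2 + m)

  3<5+m : 3 < 5 + m
  3<5+m = ℕₚ.m≤m+n 4 (1 + m)

  4<5+m : 4 < 5 + m
  4<5+m = ℕₚ.m≤m+n 5 m

  shift : Endo (5 + m)
  shift = rotate 2

  shift-derangement : EvenDerangement shift
  shift-derangement =
    even-cong (rotate-+ 1 1) (square-even (rotate 1) (rotate-injective 1)) ,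
    rotate-derangement 2 (s≤s z≤n) 2<5+m

  shift²-derangement : EvenDerangement (shift ∘ shift)
  shift²-derangement =
    even-∘ (proj₁ shift-derangement) (proj₁ shift-derangement) ,
    λ i eq → rotate-derangement 4 (s≤s z≤n) 4<5+m i (trans (sym (rotate-+ 2 2 i)) eq)

  c₀ : Endo (5 + m)
  c₀ = cycle3 0F 1F 2F

  -- c₀ sends 0, 1, 2 to 2, 0, 1, and shift adds 2 to each of these without wrapping around.
  shift∘c₀-derangement : EvenDerangement (shift ∘ c₀)
  shift∘c₀-derangement = even-∘ (proj₁ shift-derangement) (cycle3-even (λ ()) (λ ())) , fixless
    where
    fixless : ∀ i → shift (c₀ i) ≢ i
    fixless 0F eq with () ← trans (sym (toℕ-rotate-small {4 + m} 2 2F 4<5+m)) (cong toℕ eq)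
    fixless 1F eq with () ← trans (sym (toℕ-rotate-small {4 + m} 2 0F 2<5+m)) (cong toℕ eq)
    fixless 2F eq with () ← trans (sym (toℕ-rotate-small {4 + m} 2 1F 3<5+m)) (cong toℕ eq)
    fixless i@(suc (suc (suc _))) = proj₂ shift-derangement i

  shift-injective : Inj shift
  shift-injective = proj₁ (proj₁ shift-derangement)

  identity₂ : Product {5 + m} 2 id
  identity₂ = product-cong
    (product-∘ (product₁ shift-derangement) (product₁ (derangement-inverse shift shift-derangement)))
    (inverseʳ shift shift-injective)

  identity₃ : Product {5 + m} 3 id
  identity₃ = product-cong
    (product-∘ (product₁ shift-derangement)
               (product-∘ (product₁ shift-derangement)
                          (product₁ (derangement-inverse (shift ∘ shift) shift²-derangement))))
    (inverseʳ (shift ∘ shift) (proj₁ (proj₁ shift²-derangement)))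

  identity-product : ∀ j → Product {5 + m} (2 + j) id
  identity-product zero          = identity₂
  identity-product (suc zero)    = identity₃
  identity-product (suc (suc j)) = product-∘ identity₂ (identity-product j)

  c₀-product : Product 2 c₀
  c₀-product = product-cong
    (product-∘ (product₁ (derangement-inverse shift shift-derangement)) (product₁ shift∘c₀-derangement))
    (inverseˡ shift shift-injective ∘ c₀)

  -- Every 3-cycle is conjugate to c₀.
  cycle-product : {a b c : Fin (5 + m)} → a ≢ b → a ≢ c → b ≢ c → Product 2 (cycle3 a b c)
  cycle-product {a} {b} {c} a≢b a≢c b≢c with place₃ a b c a≢b a≢c b≢c
  ... | π , π-inj , refl , refl , refl = product-conj π π-inj (cycle3-conj π π-inj 0F 1F 2F) c₀-product

  even⇒long-products : (t : Endo (5 + m)) → Even t → ∃ λ K → ∀ j → Product (K + j) t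
  even⇒long-products t t-even with even⇒product cycle-product t t-even
  ... | k , p = k + 2 , λ j →
    subst (λ l → Product l t) (sym (ℕₚ.+-assoc k 2 j)) (product-∘ p (identity-product j))

  -- Any two vertices of AΓ_n are joined by walks of every large length: with t = g⁻¹ ∘ h even,
  -- h = g ∘ t and t is a product of k even derangements for all large k.
  long-walks : {g h : Perm (5 + m)} → InA g → InA h → LongWalks AdjA g h
  long-walks {g} {h} g∈A h∈A =
    proj₁ products ,
    λ j → product⇒walk (proj₂ products j) g h g∈A (λ i → sym (inverseʳ (lookup g) g-inj (lookup h i)))
    where
    g-even = Equivalence.to (InA⇔even g) g∈A
    g-inj = proj₁ g-even
    t = inverse (lookup g) g-inj ∘ lookup h
    t-even = even-∘ (even-inverse (lookup g) g-even) (Equivalence.to (InA⇔even h) h∈A)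
    products = even⇒long-products t t-even

  -- The identity vertex lies on a triangle, since the identity is a product of 3 even derangements.
  e : Perm (5 + m)
  e = tabulate id

  triangle : Walk AdjA 3 e e
  triangle = product⇒walk identity₃ e e e∈A (λ _ → refl)
    where
    e∈A : InA e
    e∈A = Equivalence.from (InA⇔even e)
                           (even-cong (sym ∘ Vecₚ.lookup∘tabulate id) (id , parity-id {5 + m}))

  connected : ∀ q → ConnectedQ (5 + m) q
  connected q u v u∈A v∈A = walk⇒star (proj₂ (tensor-long-walks long-walks u∈A v∈A) 0)

  non-bipartite : ∀ q → ¬ BipartiteQ (5 + m) q
  non-bipartite q = odd-closed-walk⇒¬2-colourable (triangles q) refl
    where
    triangles : ∀ q → Walk AdjQ 3 (Vec.replicate q e) (Vec.replicate q e)
    triangles zero    = walk-[] 3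
    triangles (suc q) = walk-∷ triangle (triangles q)

theorem2p4 : ∀ (q n : ℕ) → 1 ≤ q → 5 ≤ n → ConnectedQ n q × ¬ BipartiteQ n q
theorem2p4 q n _ 5≤n with m , refl ← ℕₚ.m≤n⇒∃[o]m+o≡n 5≤n =
  AtLeastFive.connected m q , AtLeastFive.non-bipartite m q
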